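{- There exist a tournament $T_{clause}$ and pairwise disjoint arcs $uv, wx, yz$ of $T_{clause}$ such that: $\vec{\omega}(T_{clause}) = 3$; for every $\vec{\omega}$-ordering of $T_{clause}$, at least one of $uv, wx, yz$ is backward; and for every two of the arcs $uv, wx, yz$ there exists a $\vec{\omega}$-ordering in which these two arcs are forward.
   Context: A tournament is an orientation of a complete graph. For a tournament $T$ and a total order $\prec$ of $V(T)$, an arc $ab$ is forward if $a \prec b$ and backward otherwise; the backedge graph $T^{\prec}$ is the undirected graph on $V(T)$ whose edges are the pairs forming backward arcs. $\vec{\omega}(T) = \min_{\prec} \omega(T^{\prec})$ over all total orders, and a $\vec{\omega}$-ordering of $T$ is a total order $\prec$ with $\omega(T^{\prec}) = \vec{\omega}(T)$. -}

module Defs where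

open import Data.Nat using (ℕ; suc)
open import Data.Bool using (Bool; true; false; not)
open import Data.Fin using (Fin; _<_)
open import Data.Fin.Permutation using (Permutation′; _⟨$⟩ʳ_)
open import Data.Product using (Σ; _×_; ∃)
open import Data.Sum using (_⊎_)
open import Relation.Nullary using (¬_)
open import Relation.Binary.PropositionalEquality using (_≡_; _≢_)
open import Function.Definitions using (Injective)

-- A tournament on vertex set Fin n: arc a b ≡ true means the arc ab (a → b) is present.
-- Orientation of the complete graph: no loops, and between distinct vertices exactly one arc.
record Tournament (n : ℕ) : Set where
  field
    arc     : Fin n → Fin n → Bool
    irrefl  : ∀ a → arc a a ≡ false
    orient  : ∀ a b → a ≢ b → arc a b ≡ not (arc b a)
open Tournament public

-- A total order on Fin n, given by the position of each vertex (a bijection Fin n ↔ Fin n).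
Order : ℕ → Set
Order n = Permutation′ n

_≺[_]_ : ∀ {n} → Fin n → Order n → Fin n → Set
a ≺[ σ ] b = (σ ⟨$⟩ʳ a) < (σ ⟨$⟩ʳ b)

Forward : ∀ {n} → Order n → Fin n → Fin n → Set
Forward σ a b = a ≺[ σ ] b

Backward : ∀ {n} → Order n → Fin n → Fin n → Set
Backward σ a b = b ≺[ σ ] a

BackEdge : ∀ {n} → Tournament n → Order n → Fin n → Fin n → Set
BackEdge T σ a b = (arc T a b ≡ true × Backward σ a b) ⊎ (arc T b a ≡ true × Backward σ b a)

HasClique : ∀ {n} → (Fin n → Fin n → Set) → ℕ → Set
HasClique {n} E k = Σ (Fin k → Fin n) λ f → Injective _≡_ _≡_ f × (∀ i j → i ≢ j → E (f i) (f j))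

CliqueNumber : ∀ {n} → (Fin n → Fin n → Set) → ℕ → Set
CliqueNumber E k = HasClique E k × ¬ HasClique E (suc k)

-- ω⃗(T) = k : minimum over all total orders of ω(T^σ) equals k
OmegaVec : ∀ {n} → Tournament n → ℕ → Set
OmegaVec T k = ∃ (λ σ → CliqueNumber (BackEdge T σ) k) × (∀ σ → HasClique (BackEdge T σ) k)

IsOmegaOrdering : ∀ {n} → Tournament n → Order n → Set
IsOmegaOrdering T σ = Σ ℕ λ k → OmegaVec T k × CliqueNumber (BackEdge T σ) k

PairDisjoint : ∀ {n} → Fin n → Fin n → Fin n → Fin n → Set
PairDisjoint a b c d = a ≢ c × a ≢ d × b ≢ c × b ≢ d

-- Every vertex of the Paley tournament on seven vertices dominates a cyclic triangle, and
-- a cyclic triangle has a backward arc in every order; so in every order the last vertex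
-- of a Paley block spans a backward triangle with that arc, and ω⃗ ≥ 3.
-- T_clause consists of a six-vertex gadget carrying the arcs uv, wx, yz and two Paley
-- blocks P₁, P₂ with {v, x, z} ⇒ P₁ ⇒ P₂ ⇒ gadget.  If uv, wx, yz are all forward, the
-- last vertex of the gadget is one of v, x, z, each of which dominates a cyclic triangle
-- inside the gadget, so the gadget spans a backward triangle as well.  The last vertex of
-- the whole order lies in {v, x, z}, P₁ or P₂, and beats the backward triangle of P₁, P₂
-- or the gadget respectively: a backward K₄.  Three explicit orders, each with two of the
-- arcs forward, have K₄-free backedge graphs, which is checked by computation.
module Submission where

open import Defs
open import Data.Bool using (Bool; true; false; not)
open import Data.Bool.Properties using () renaming (_≟_ to _≟ᵇ_)
open import Data.Empty using (⊥-elim)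
open import Data.Fin using (Fin; zero; suc; #_; toℕ; fromℕ; inject≤; _≤_)
open import Data.Fin.Properties using (_≟_; _<?_; <-cmp; ≤fromℕ; inject≤-injective; all?; toℕ-injective)
open import Data.Fin.Permutation using (permutation; _⟨$⟩ʳ_; _⟨$⟩ˡ_; inverseˡ; inverseʳ)
open import Data.List using (List; []; _∷_)
open import Data.List.Extrema.Nat using (argmax; f[⊥]≤f[argmax]; f[xs]≤f[argmax]; argmax-all)
open import Data.List.Membership.Propositional using (_∈_; find)
open import Data.List.Membership.DecPropositional (_≟_ {20}) using (_∈?_)
open import Data.List.Relation.Unary.All as All using (All)
open import Data.List.Relation.Unary.Any using (Any; here; there; any?)
open import Data.Nat using (ℕ; suc; _≡ᵇ_) renaming (_≤_ to _≤ℕ_)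
import Data.Nat.Properties as ℕ
open import Data.Product using (Σ; ∃; _×_; _,_)
open import Data.Sum using (_⊎_; inj₁; inj₂)
open import Data.Vec using (Vec; []; _∷_; lookup)
open import Data.Vec.Functional using () renaming (_∷_ to _∷ᶠ_; [] to []ᶠ)
open import Function using (_∘_)
open import Function.Definitions using (Injective)
open import Relation.Binary using (Decidable; tri<; tri≈; tri>)
open import Relation.Binary.PropositionalEquality using (_≡_; _≢_; refl; sym; trans; cong; subst)
open import Relation.Nullary using (¬_; Dec; ¬?; _×-dec_; _⊎-dec_; _→-dec_)
open import Relation.Nullary.Decidable using (True; toWitness; from-yes)

IsClique : ∀ {n k} → (Fin n → Fin n → Set) → (Fin k → Fin n) → Set
IsClique E f = Injective _≡_ _≡_ f × (∀ i j → i ≢ j → E (f i) (f j))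

HasClique-≤ : ∀ {n} {E : Fin n → Fin n → Set} {j k} → j ≤ℕ k → HasClique E k → HasClique E j
HasClique-≤ {j = j} {k} j≤k (f , f-injective , f-adjacent) =
  f ∘ inject , inject-injective ∘ f-injective , λ i i′ i≢i′ → f-adjacent _ _ (i≢i′ ∘ inject-injective)
  where
  inject : Fin j → Fin k
  inject i = inject≤ i j≤k
  inject-injective : Injective _≡_ _≡_ inject
  inject-injective = inject≤-injective j≤k j≤k _ _

module _ {n} {E : Fin n → Fin n → Set} (E-sym : ∀ {a b} → E a b → E b a) (E-irrefl : ∀ {a} → ¬ E a a) where

  emptyClique : IsClique E []ᶠ
  emptyClique = (λ { {()} }) , λ ()

  extendClique : ∀ {k t} {f : Fin k → Fin n} → IsClique E f → (∀ i → E t (f i)) → IsClique E (t ∷ᶠ f)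
  extendClique {t = t} {f} (f-injective , f-adjacent) t~f = injective , adjacent
    where
    injective : Injective _≡_ _≡_ (t ∷ᶠ f)
    injective {zero}  {zero}  _  = refl
    injective {zero}  {suc j} eq = ⊥-elim (E-irrefl (subst (E t) (sym eq) (t~f j)))
    injective {suc i} {zero}  eq = ⊥-elim (E-irrefl (subst (E t) eq (t~f i)))
    injective {suc i} {suc j} eq = cong suc (f-injective eq)
    adjacent : ∀ i j → i ≢ j → E ((t ∷ᶠ f) i) ((t ∷ᶠ f) j)
    adjacent zero    zero    i≢j = ⊥-elim (i≢j refl)
    adjacent zero    (suc j) _   = t~f j
    adjacent (suc i) zero    _   = E-sym (t~f i)
    adjacent (suc i) (suc j) i≢j = f-adjacent i j (i≢j ∘ cong suc)

-- The adjacencies are interleaved with the quantifiers so that deciding it prunes early.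
K4Free : ∀ {n} → (Fin n → Fin n → Set) → Set
K4Free E = ∀ a b → E a b → ∀ c → E a c → E b c → ∀ d → E a d → E b d → ¬ E c d

K4Free? : ∀ {n} {E : Fin n → Fin n → Set} → Decidable E → Dec (K4Free E)
K4Free? E? =
  all? λ a → all? λ b → E? a b →-dec all? λ c → E? a c →-dec E? b c →-dec
  all? λ d → E? a d →-dec E? b d →-dec ¬? (E? c d)

K4Free⇒¬K4 : ∀ {n} {E : Fin n → Fin n → Set} → K4Free E → ¬ HasClique E 4
K4Free⇒¬K4 free (f , _ , adj) =
  free (f (# 0)) (f (# 1)) (adj _ _ λ ()) (f (# 2)) (adj _ _ λ ()) (adj _ _ λ ())
       (f (# 3)) (adj _ _ λ ()) (adj _ _ λ ()) (adj _ _ λ ())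

_⪯[_]_ : ∀ {n} → Fin n → Order n → Fin n → Set
a ⪯[ σ ] b = σ ⟨$⟩ʳ a ≤ σ ⟨$⟩ʳ b

lastVertex : ∀ {n} (σ : Order (suc n)) → ∃ λ t → ∀ a → a ⪯[ σ ] t
lastVertex {n} σ = σ ⟨$⟩ˡ fromℕ n , λ a → subst (σ ⟨$⟩ʳ a ≤_) (sym (inverseʳ σ)) (≤fromℕ _)

forward? : ∀ {n} (σ : Order n) a b → Dec (Forward σ a b)
forward? σ a b = σ ⟨$⟩ʳ a <? σ ⟨$⟩ʳ b

module _ {n} (σ : Order n) where

  ≺-irrefl : ∀ {a} → ¬ a ≺[ σ ] a
  ≺-irrefl = ℕ.<-irrefl refl

  position-injective : ∀ {a b} → σ ⟨$⟩ʳ a ≡ σ ⟨$⟩ʳ b → a ≡ b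
  position-injective eq = trans (sym (inverseˡ σ)) (trans (cong (σ ⟨$⟩ˡ_) eq) (inverseˡ σ))

  ≺-connex : ∀ {a b} → a ≢ b → a ≺[ σ ] b ⊎ b ≺[ σ ] a
  ≺-connex {a} {b} a≢b with <-cmp (σ ⟨$⟩ʳ a) (σ ⟨$⟩ʳ b)
  ... | tri< a≺b _ _ = inj₁ a≺b
  ... | tri≈ _ eq _  = ⊥-elim (a≢b (position-injective eq))
  ... | tri> _ _ b≺a = inj₂ b≺a

  ⪯∧≢⇒≺ : ∀ {a b} → a ⪯[ σ ] b → a ≢ b → a ≺[ σ ] b
  ⪯∧≢⇒≺ a⪯b a≢b = ℕ.≤∧≢⇒< a⪯b (a≢b ∘ position-injective ∘ toℕ-injective)

  latestIn : ∀ x xs → ∃ λ m → m ∈ x ∷ xs × All (_⪯[ σ ] m) (x ∷ xs)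
  latestIn x xs =
    argmax position x xs ,
    argmax-all position (here refl) (All.tabulate there) ,
    f[⊥]≤f[argmax] {f = position} x xs All.∷ f[xs]≤f[argmax] {f = position} x xs
    where
    position : Fin n → ℕ
    position = toℕ ∘ (σ ⟨$⟩ʳ_)

BackArc : ∀ {n} → Tournament n → Order n → Fin n → Fin n → Set
BackArc T σ a b = arc T a b ≡ true × Backward σ a b

CyclicTriangle : ∀ {n} → Tournament n → Fin n → Fin n → Fin n → Set
CyclicTriangle T a b c = arc T a b ≡ true × arc T b c ≡ true × arc T c a ≡ true

Dominates : ∀ {n} → Tournament n → Fin n → List (Fin n) → Set
Dominates T t S = All (λ s → arc T t s ≡ true) S

dominates? : ∀ {n} (T : Tournament n) t S → Dec (Dominates T t S)
dominates? T t = All.all? λ s → arc T t s ≟ᵇ true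

DominatesCycleIn : ∀ {n} → Tournament n → List (Fin n) → Fin n → Set
DominatesCycleIn T S m =
  Any (λ a → Any (λ b → Any (λ c → Dominates T m (a ∷ b ∷ c ∷ []) × CyclicTriangle T a b c) S) S) S

dominatesCycleIn? : ∀ {n} (T : Tournament n) S m → Dec (DominatesCycleIn T S m)
dominatesCycleIn? T S m =
  any? (λ a → any? (λ b → any? (λ c →
    dominates? T m (a ∷ b ∷ c ∷ []) ×-dec a ⇒? b ×-dec b ⇒? c ×-dec c ⇒? a) S) S) S
  where
  _⇒?_ : ∀ a b → Dec (arc T a b ≡ true)
  a ⇒? b = arc T a b ≟ᵇ true

arc⇒≢ : ∀ {n} (T : Tournament n) {a b} → arc T a b ≡ true → a ≢ b
arc⇒≢ T {a} ab refl with () ← trans (sym ab) (irrefl T a)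

module _ {n} (T : Tournament n) (σ : Order n) where

  BackEdge-sym : ∀ {a b} → BackEdge T σ a b → BackEdge T σ b a
  BackEdge-sym (inj₁ ab) = inj₂ ab
  BackEdge-sym (inj₂ ba) = inj₁ ba

  BackEdge-irrefl : ∀ {a} → ¬ BackEdge T σ a a
  BackEdge-irrefl (inj₁ (_ , a≺a)) = ≺-irrefl σ a≺a
  BackEdge-irrefl (inj₂ (_ , a≺a)) = ≺-irrefl σ a≺a

  extendBackClique : ∀ {k t} {f : Fin k → Fin n} → IsClique (BackEdge T σ) f →
                     (∀ i → BackArc T σ t (f i)) → IsClique (BackEdge T σ) (t ∷ᶠ f)
  extendBackClique f-clique t⇒f =
    extendClique {E = BackEdge T σ} BackEdge-sym BackEdge-irrefl f-clique (inj₁ ∘ t⇒f)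

  BackArc? : Decidable (BackArc T σ)
  BackArc? a b = (arc T a b ≟ᵇ true) ×-dec (σ ⟨$⟩ʳ b <? σ ⟨$⟩ʳ a)

  BackEdge? : Decidable (BackEdge T σ)
  BackEdge? a b = BackArc? a b ⊎-dec BackArc? b a

  dominated⇒BackArc : ∀ {t a} → a ⪯[ σ ] t → arc T t a ≡ true → BackArc T σ t a
  dominated⇒BackArc a⪯t t⇒a = t⇒a , ⪯∧≢⇒≺ σ a⪯t (arc⇒≢ T t⇒a ∘ sym)

  cyclicTriangle-BackArc : ∀ {a b c} → CyclicTriangle T a b c →
                           BackArc T σ a b ⊎ BackArc T σ b c ⊎ BackArc T σ c a
  cyclicTriangle-BackArc (ab , bc , ca) with ≺-connex σ (arc⇒≢ T ab)
  ... | inj₂ b≺a = inj₁ (ab , b≺a)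
  ... | inj₁ a≺b with ≺-connex σ (arc⇒≢ T bc)
  ...   | inj₂ c≺b = inj₂ (inj₁ (bc , c≺b))
  ...   | inj₁ b≺c = inj₂ (inj₂ (ca , ℕ.<-trans a≺b b≺c))

  BackCliqueIn : (Fin n → Set) → ℕ → Set
  BackCliqueIn P k = Σ (Fin k → Fin n) λ f → IsClique (BackEdge T σ) f × (∀ i → P (f i))

  backTriangle : ∀ {P m a b} → P m → P a → P b →
                 BackArc T σ m a → BackArc T σ m b → BackArc T σ a b → BackCliqueIn P 3
  backTriangle {m = m} {a} {b} m∈P a∈P b∈P ma mb ab =
    m ∷ᶠ a ∷ᶠ b ∷ᶠ []ᶠ ,
    extendBackClique (extendBackClique (extendBackClique emptyBackClique λ ()) λ { zero → ab })
                     (λ { zero → ma ; (suc zero) → mb }) ,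
    λ { zero → m∈P ; (suc zero) → a∈P ; (suc (suc zero)) → b∈P }
    where
    emptyBackClique : IsClique (BackEdge T σ) []ᶠ
    emptyBackClique = emptyClique {E = BackEdge T σ} BackEdge-sym BackEdge-irrefl

  dominatedCycle⇒backTriangle : ∀ {P m a b c} → P m → P a → P b → P c →
    BackArc T σ m a → BackArc T σ m b → BackArc T σ m c → CyclicTriangle T a b c → BackCliqueIn P 3
  dominatedCycle⇒backTriangle m∈P a∈P b∈P c∈P ma mb mc abc with cyclicTriangle-BackArc abc
  ... | inj₁ ab        = backTriangle m∈P a∈P b∈P ma mb ab
  ... | inj₂ (inj₁ bc) = backTriangle m∈P b∈P c∈P mb mc bc
  ... | inj₂ (inj₂ ca) = backTriangle m∈P c∈P a∈P mc ma ca

  -- Only the last vertex of S has to dominate a cycle; in the gadget only v, x, z do.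
  backTriangleIn : ∀ {x xs} →
                   (∀ {m} → m ∈ x ∷ xs → All (_⪯[ σ ] m) (x ∷ xs) → DominatesCycleIn T (x ∷ xs) m) →
                   BackCliqueIn (_∈ x ∷ xs) 3
  backTriangleIn {x} {xs} latest-dominatesCycle with latestIn σ x xs
  ... | m , m∈S , S⪯m with find (latest-dominatesCycle m∈S S⪯m)
  ... | a , a∈S , b-cycles with find b-cycles
  ... | b , b∈S , c-cycles with find c-cycles
  ... | c , c∈S , (m⇒a All.∷ m⇒b All.∷ m⇒c All.∷ All.[]) , abc =
    dominatedCycle⇒backTriangle m∈S a∈S b∈S c∈S
                                (beaten a∈S m⇒a) (beaten b∈S m⇒b) (beaten c∈S m⇒c) abc
    where
    beaten : ∀ {s} → s ∈ x ∷ xs → arc T m s ≡ true → BackArc T σ m s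
    beaten s∈S = dominated⇒BackArc (All.lookup S⪯m s∈S)

  extendBackCliqueByLast : ∀ {t k S} → (∀ a → a ⪯[ σ ] t) → Dominates T t S →
                          BackCliqueIn (_∈ S) k → HasClique (BackEdge T σ) (suc k)
  extendBackCliqueByLast {t} t-last t⇒S (f , f-clique , f∈S) =
    t ∷ᶠ f ,
    extendBackClique f-clique (λ i → dominated⇒BackArc (t-last _) (All.lookup t⇒S (f∈S i)))

OmegaVec-unique : ∀ {n} {T : Tournament n} {j k} → OmegaVec T j → OmegaVec T k → j ≡ k
OmegaVec-unique {T = T} {j} {k} ((σ , _ , σ-noSucJ) , allJ) ((τ , _ , τ-noSucK) , allK) with ℕ.<-cmp j k
... | tri< j<k _ _ = ⊥-elim (σ-noSucJ (HasClique-≤ {E = BackEdge T σ} j<k (allK σ)))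
... | tri≈ _ j≡k _ = j≡k
... | tri> _ _ k<j = ⊥-elim (τ-noSucK (HasClique-≤ {E = BackEdge T τ} k<j (allJ τ)))

omegaOrdering-noClique : ∀ {n} {T : Tournament n} {σ k} → OmegaVec T k → IsOmegaOrdering T σ →
                         ¬ HasClique (BackEdge T σ) (suc k)
omegaOrdering-noClique {T = T} {σ} ω (j , ωj , _ , σ-noSucJ) =
  subst (λ k → ¬ HasClique (BackEdge T σ) (suc k)) (OmegaVec-unique {T = T} ωj ω) σ-noSucJ

orderFromVecs : ∀ {n} (positionOf vertexAt : Vec (Fin n) n) →
                {True (all? λ i → lookup positionOf (lookup vertexAt i) ≟ i)} →
                {True (all? λ a → lookup vertexAt (lookup positionOf a) ≟ a)} → Order n
orderFromVecs p v {pv} {vp} = permutation (lookup p) (lookup v) (toWitness pv) (toWitness vp)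

-- The clause gadget is {u, v, w, x, y, z} = {0, …, 5}; vertices 6–12 and 13–19 form the
-- Paley blocks P₁ and P₂, in which i → i + 1, i + 2, i + 4 (mod 7).
adjacency : Vec (Vec ℕ 20) 20
adjacency =
    (0 ∷ 1 ∷ 1 ∷ 0 ∷ 0 ∷ 0 ∷ 1 ∷ 0 ∷ 1 ∷ 1 ∷ 0 ∷ 0 ∷ 0 ∷ 0 ∷ 0 ∷ 0 ∷ 0 ∷ 0 ∷ 0 ∷ 0 ∷ [])
  ∷ (0 ∷ 0 ∷ 1 ∷ 0 ∷ 1 ∷ 1 ∷ 1 ∷ 1 ∷ 1 ∷ 1 ∷ 1 ∷ 1 ∷ 1 ∷ 0 ∷ 0 ∷ 0 ∷ 0 ∷ 0 ∷ 0 ∷ 0 ∷ [])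
  ∷ (0 ∷ 0 ∷ 0 ∷ 1 ∷ 1 ∷ 0 ∷ 1 ∷ 0 ∷ 0 ∷ 0 ∷ 1 ∷ 1 ∷ 0 ∷ 0 ∷ 0 ∷ 0 ∷ 0 ∷ 0 ∷ 0 ∷ 0 ∷ [])
  ∷ (1 ∷ 1 ∷ 0 ∷ 0 ∷ 1 ∷ 0 ∷ 1 ∷ 1 ∷ 1 ∷ 1 ∷ 1 ∷ 1 ∷ 1 ∷ 0 ∷ 0 ∷ 0 ∷ 0 ∷ 0 ∷ 0 ∷ 0 ∷ [])
  ∷ (1 ∷ 0 ∷ 0 ∷ 0 ∷ 0 ∷ 1 ∷ 1 ∷ 0 ∷ 1 ∷ 0 ∷ 1 ∷ 1 ∷ 0 ∷ 0 ∷ 0 ∷ 0 ∷ 0 ∷ 0 ∷ 0 ∷ 0 ∷ [])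
  ∷ (1 ∷ 0 ∷ 1 ∷ 1 ∷ 0 ∷ 0 ∷ 1 ∷ 1 ∷ 1 ∷ 1 ∷ 1 ∷ 1 ∷ 1 ∷ 0 ∷ 0 ∷ 0 ∷ 0 ∷ 0 ∷ 0 ∷ 0 ∷ [])
  ∷ (0 ∷ 0 ∷ 0 ∷ 0 ∷ 0 ∷ 0 ∷ 0 ∷ 1 ∷ 1 ∷ 0 ∷ 1 ∷ 0 ∷ 0 ∷ 1 ∷ 1 ∷ 1 ∷ 1 ∷ 1 ∷ 1 ∷ 1 ∷ [])
  ∷ (1 ∷ 0 ∷ 1 ∷ 0 ∷ 1 ∷ 0 ∷ 0 ∷ 0 ∷ 1 ∷ 1 ∷ 0 ∷ 1 ∷ 0 ∷ 1 ∷ 1 ∷ 1 ∷ 1 ∷ 1 ∷ 1 ∷ 1 ∷ [])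
  ∷ (0 ∷ 0 ∷ 1 ∷ 0 ∷ 0 ∷ 0 ∷ 0 ∷ 0 ∷ 0 ∷ 1 ∷ 1 ∷ 0 ∷ 1 ∷ 1 ∷ 1 ∷ 1 ∷ 1 ∷ 1 ∷ 1 ∷ 1 ∷ [])
  ∷ (0 ∷ 0 ∷ 1 ∷ 0 ∷ 1 ∷ 0 ∷ 1 ∷ 0 ∷ 0 ∷ 0 ∷ 1 ∷ 1 ∷ 0 ∷ 1 ∷ 1 ∷ 1 ∷ 1 ∷ 1 ∷ 1 ∷ 1 ∷ [])
  ∷ (1 ∷ 0 ∷ 0 ∷ 0 ∷ 0 ∷ 0 ∷ 0 ∷ 1 ∷ 0 ∷ 0 ∷ 0 ∷ 1 ∷ 1 ∷ 1 ∷ 1 ∷ 1 ∷ 1 ∷ 1 ∷ 1 ∷ 1 ∷ [])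
  ∷ (1 ∷ 0 ∷ 0 ∷ 0 ∷ 0 ∷ 0 ∷ 1 ∷ 0 ∷ 1 ∷ 0 ∷ 0 ∷ 0 ∷ 1 ∷ 1 ∷ 1 ∷ 1 ∷ 1 ∷ 1 ∷ 1 ∷ 1 ∷ [])
  ∷ (1 ∷ 0 ∷ 1 ∷ 0 ∷ 1 ∷ 0 ∷ 1 ∷ 1 ∷ 0 ∷ 1 ∷ 0 ∷ 0 ∷ 0 ∷ 1 ∷ 1 ∷ 1 ∷ 1 ∷ 1 ∷ 1 ∷ 1 ∷ [])
  ∷ (1 ∷ 1 ∷ 1 ∷ 1 ∷ 1 ∷ 1 ∷ 0 ∷ 0 ∷ 0 ∷ 0 ∷ 0 ∷ 0 ∷ 0 ∷ 0 ∷ 1 ∷ 1 ∷ 0 ∷ 1 ∷ 0 ∷ 0 ∷ [])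
  ∷ (1 ∷ 1 ∷ 1 ∷ 1 ∷ 1 ∷ 1 ∷ 0 ∷ 0 ∷ 0 ∷ 0 ∷ 0 ∷ 0 ∷ 0 ∷ 0 ∷ 0 ∷ 1 ∷ 1 ∷ 0 ∷ 1 ∷ 0 ∷ [])
  ∷ (1 ∷ 1 ∷ 1 ∷ 1 ∷ 1 ∷ 1 ∷ 0 ∷ 0 ∷ 0 ∷ 0 ∷ 0 ∷ 0 ∷ 0 ∷ 0 ∷ 0 ∷ 0 ∷ 1 ∷ 1 ∷ 0 ∷ 1 ∷ [])
  ∷ (1 ∷ 1 ∷ 1 ∷ 1 ∷ 1 ∷ 1 ∷ 0 ∷ 0 ∷ 0 ∷ 0 ∷ 0 ∷ 0 ∷ 0 ∷ 1 ∷ 0 ∷ 0 ∷ 0 ∷ 1 ∷ 1 ∷ 0 ∷ [])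
  ∷ (1 ∷ 1 ∷ 1 ∷ 1 ∷ 1 ∷ 1 ∷ 0 ∷ 0 ∷ 0 ∷ 0 ∷ 0 ∷ 0 ∷ 0 ∷ 0 ∷ 1 ∷ 0 ∷ 0 ∷ 0 ∷ 1 ∷ 1 ∷ [])
  ∷ (1 ∷ 1 ∷ 1 ∷ 1 ∷ 1 ∷ 1 ∷ 0 ∷ 0 ∷ 0 ∷ 0 ∷ 0 ∷ 0 ∷ 0 ∷ 1 ∷ 0 ∷ 1 ∷ 0 ∷ 0 ∷ 0 ∷ 1 ∷ [])
  ∷ (1 ∷ 1 ∷ 1 ∷ 1 ∷ 1 ∷ 1 ∷ 0 ∷ 0 ∷ 0 ∷ 0 ∷ 0 ∷ 0 ∷ 0 ∷ 1 ∷ 1 ∷ 0 ∷ 1 ∷ 0 ∷ 0 ∷ 0 ∷ [])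
  ∷ []

arc-clause : Fin 20 → Fin 20 → Bool
arc-clause a b = lookup (lookup adjacency a) b ≡ᵇ 1

T-clause : Tournament 20
T-clause = record
  { arc    = arc-clause
  ; irrefl = from-yes (all? λ a → arc-clause a a ≟ᵇ false)
  ; orient = from-yes (all? λ a → all? λ b → ¬? (a ≟ b) →-dec arc-clause a b ≟ᵇ not (arc-clause b a))
  }

u v w x y z : Fin 20
u = # 0
v = # 1
w = # 2
x = # 3
y = # 4
z = # 5

gadget tails heads P₁ P₂ : List (Fin 20)
gadget = u ∷ v ∷ w ∷ x ∷ y ∷ z ∷ []
tails  = u ∷ w ∷ y ∷ []
heads  = v ∷ x ∷ z ∷ []
P₁     = # 6 ∷ # 7 ∷ # 8 ∷ # 9 ∷ # 10 ∷ # 11 ∷ # 12 ∷ []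
P₂     = # 13 ∷ # 14 ∷ # 15 ∷ # 16 ∷ # 17 ∷ # 18 ∷ # 19 ∷ []

vertex-blocks : ∀ a → a ∈ tails ⊎ a ∈ heads ⊎ a ∈ P₁ ⊎ a ∈ P₂
vertex-blocks = from-yes (all? λ a → a ∈? tails ⊎-dec a ∈? heads ⊎-dec a ∈? P₁ ⊎-dec a ∈? P₂)

heads⇒P₁ : All (λ h → Dominates T-clause h P₁) heads
heads⇒P₁ = from-yes (All.all? (λ h → dominates? T-clause h P₁) heads)

P₁⇒P₂ : All (λ p → Dominates T-clause p P₂) P₁
P₁⇒P₂ = from-yes (All.all? (λ p → dominates? T-clause p P₂) P₁)

P₂⇒gadget : All (λ p → Dominates T-clause p gadget) P₂
P₂⇒gadget = from-yes (All.all? (λ p → dominates? T-clause p gadget) P₂)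

P₁-dominatesCycles : All (DominatesCycleIn T-clause P₁) P₁
P₁-dominatesCycles = from-yes (All.all? (dominatesCycleIn? T-clause P₁) P₁)

P₂-dominatesCycles : All (DominatesCycleIn T-clause P₂) P₂
P₂-dominatesCycles = from-yes (All.all? (dominatesCycleIn? T-clause P₂) P₂)

heads-dominateCycles : All (DominatesCycleIn T-clause gadget) heads
heads-dominateCycles = from-yes (All.all? (dominatesCycleIn? T-clause gadget) heads)

gadget-split : All (λ a → a ∈ tails ⊎ a ∈ heads) gadget
gadget-split = from-yes (All.all? (λ a → a ∈? tails ⊎-dec a ∈? heads) gadget)

ClauseForward : Order 20 → Set
ClauseForward σ = Forward σ u v × Forward σ w x × Forward σ y z

module _ (σ : Order 20) where

  P₁-backTriangle : BackCliqueIn T-clause σ (_∈ P₁) 3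
  P₁-backTriangle = backTriangleIn T-clause σ λ m∈P₁ _ → All.lookup P₁-dominatesCycles m∈P₁

  P₂-backTriangle : BackCliqueIn T-clause σ (_∈ P₂) 3
  P₂-backTriangle = backTriangleIn T-clause σ λ m∈P₂ _ → All.lookup P₂-dominatesCycles m∈P₂

  tail-notLatest : ClauseForward σ → ∀ {t} → t ∈ tails → ¬ All (_⪯[ σ ] t) gadget
  tail-notLatest (u≺v , _ , _) (here refl) gadget⪯u =
    ℕ.<⇒≱ u≺v (All.lookup gadget⪯u (there (here refl)))
  tail-notLatest (_ , w≺x , _) (there (here refl)) gadget⪯w =
    ℕ.<⇒≱ w≺x (All.lookup gadget⪯w (there (there (there (here refl)))))
  tail-notLatest (_ , _ , y≺z) (there (there (here refl))) gadget⪯y =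
    ℕ.<⇒≱ y≺z (All.lookup gadget⪯y (there (there (there (there (there (here refl)))))))

  gadget-backTriangle : ClauseForward σ → BackCliqueIn T-clause σ (_∈ gadget) 3
  gadget-backTriangle forward = backTriangleIn T-clause σ latest-dominatesCycle
    where
    latest-dominatesCycle : ∀ {m} → m ∈ gadget → All (_⪯[ σ ] m) gadget → DominatesCycleIn T-clause gadget m
    latest-dominatesCycle m∈gadget gadget⪯m with All.lookup gadget-split m∈gadget
    ... | inj₁ m∈tails = ⊥-elim (tail-notLatest forward m∈tails gadget⪯m)
    ... | inj₂ m∈heads = All.lookup heads-dominateCycles m∈heads

  latest⇒backK4 : ClauseForward σ → ∀ {t} → (∀ a → a ⪯[ σ ] t) →
                  t ∈ tails ⊎ t ∈ heads ⊎ t ∈ P₁ ⊎ t ∈ P₂ → HasClique (BackEdge T-clause σ) 4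
  latest⇒backK4 forward t-last (inj₁ t∈tails) =
    ⊥-elim (tail-notLatest forward t∈tails (All.tabulate λ _ → t-last _))
  latest⇒backK4 forward t-last (inj₂ (inj₁ t∈heads)) =
    extendBackCliqueByLast T-clause σ t-last (All.lookup heads⇒P₁ t∈heads) P₁-backTriangle
  latest⇒backK4 forward t-last (inj₂ (inj₂ (inj₁ t∈P₁))) =
    extendBackCliqueByLast T-clause σ t-last (All.lookup P₁⇒P₂ t∈P₁) P₂-backTriangle
  latest⇒backK4 forward t-last (inj₂ (inj₂ (inj₂ t∈P₂))) =
    extendBackCliqueByLast T-clause σ t-last (All.lookup P₂⇒gadget t∈P₂)
                           (gadget-backTriangle forward)

  clauseForward⇒backK4 : ClauseForward σ → HasClique (BackEdge T-clause σ) 4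
  clauseForward⇒backK4 forward =
    let t , t-last = lastVertex σ in latest⇒backK4 forward t-last (vertex-blocks t)

  backTriangle-everywhere : HasClique (BackEdge T-clause σ) 3
  backTriangle-everywhere = let f , f-clique , _ = P₁-backTriangle in f , f-clique

σ-uv-wx : Order 20
σ-uv-wx = orderFromVecs
  (# 13 ∷ # 14 ∷ # 6 ∷ # 10 ∷ # 17 ∷ # 3 ∷ # 7 ∷ # 0 ∷ # 11 ∷ # 4 ∷ # 15 ∷ # 2 ∷ # 16 ∷ # 12 ∷ # 18 ∷ # 1 ∷ # 9 ∷ # 5 ∷ # 19 ∷ # 8 ∷ [])
  (# 7 ∷ # 15 ∷ # 11 ∷ # 5 ∷ # 9 ∷ # 17 ∷ # 2 ∷ # 6 ∷ # 19 ∷ # 16 ∷ # 3 ∷ # 8 ∷ # 13 ∷ # 0 ∷ # 1 ∷ # 10 ∷ # 12 ∷ # 4 ∷ # 14 ∷ # 18 ∷ [])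

σ-uv-yz : Order 20
σ-uv-yz = orderFromVecs
  (# 6 ∷ # 12 ∷ # 18 ∷ # 5 ∷ # 11 ∷ # 14 ∷ # 8 ∷ # 1 ∷ # 9 ∷ # 7 ∷ # 13 ∷ # 16 ∷ # 0 ∷ # 15 ∷ # 3 ∷ # 17 ∷ # 4 ∷ # 19 ∷ # 10 ∷ # 2 ∷ [])
  (# 12 ∷ # 7 ∷ # 19 ∷ # 14 ∷ # 16 ∷ # 3 ∷ # 0 ∷ # 9 ∷ # 6 ∷ # 8 ∷ # 18 ∷ # 4 ∷ # 1 ∷ # 10 ∷ # 5 ∷ # 13 ∷ # 11 ∷ # 15 ∷ # 2 ∷ # 17 ∷ [])

σ-wx-yz : Order 20
σ-wx-yz = orderFromVecs
  (# 19 ∷ # 2 ∷ # 7 ∷ # 15 ∷ # 8 ∷ # 11 ∷ # 9 ∷ # 0 ∷ # 12 ∷ # 3 ∷ # 13 ∷ # 4 ∷ # 16 ∷ # 6 ∷ # 10 ∷ # 14 ∷ # 17 ∷ # 18 ∷ # 1 ∷ # 5 ∷ [])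
  (# 7 ∷ # 18 ∷ # 1 ∷ # 9 ∷ # 11 ∷ # 19 ∷ # 13 ∷ # 2 ∷ # 4 ∷ # 6 ∷ # 14 ∷ # 5 ∷ # 8 ∷ # 10 ∷ # 15 ∷ # 3 ∷ # 12 ∷ # 16 ∷ # 17 ∷ # 0 ∷ [])

σ-uv-wx-K4Free : K4Free (BackEdge T-clause σ-uv-wx)
σ-uv-wx-K4Free = from-yes (K4Free? (BackEdge? T-clause σ-uv-wx))

σ-uv-yz-K4Free : K4Free (BackEdge T-clause σ-uv-yz)
σ-uv-yz-K4Free = from-yes (K4Free? (BackEdge? T-clause σ-uv-yz))

σ-wx-yz-K4Free : K4Free (BackEdge T-clause σ-wx-yz)
σ-wx-yz-K4Free = from-yes (K4Free? (BackEdge? T-clause σ-wx-yz))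

ω⃗-T-clause : OmegaVec T-clause 3
ω⃗-T-clause =
  (σ-uv-wx , backTriangle-everywhere σ-uv-wx , K4Free⇒¬K4 σ-uv-wx-K4Free) , backTriangle-everywhere

K4Free⇒omegaOrdering : ∀ σ → K4Free (BackEdge T-clause σ) → IsOmegaOrdering T-clause σ
K4Free⇒omegaOrdering σ free = 3 , ω⃗-T-clause , backTriangle-everywhere σ , K4Free⇒¬K4 free

omegaOrdering-clause : ∀ σ → IsOmegaOrdering T-clause σ →
                       Backward σ u v ⊎ Backward σ w x ⊎ Backward σ y z
omegaOrdering-clause σ σ-ω
  with ≺-connex σ {u} {v} (λ ()) | ≺-connex σ {w} {x} (λ ()) | ≺-connex σ {y} {z} (λ ())
... | inj₂ v≺u | _        | _        = inj₁ v≺u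
... | inj₁ _   | inj₂ x≺w | _        = inj₂ (inj₁ x≺w)
... | inj₁ _   | inj₁ _   | inj₂ z≺y = inj₂ (inj₂ z≺y)
... | inj₁ u≺v | inj₁ w≺x | inj₁ y≺z =
  ⊥-elim (omegaOrdering-noClique {T = T-clause} {σ} ω⃗-T-clause σ-ω
                                 (clauseForward⇒backK4 σ (u≺v , w≺x , y≺z)))

lemma3p8 : Σ ℕ λ n → Σ (Tournament n) λ T →
    Σ (Fin n) λ u → Σ (Fin n) λ v → Σ (Fin n) λ w → Σ (Fin n) λ x → Σ (Fin n) λ y → Σ (Fin n) λ z →
      (arc T u v ≡ true) × (arc T w x ≡ true) × (arc T y z ≡ true)
      × PairDisjoint u v w x × PairDisjoint u v y z × PairDisjoint w x y z
      × OmegaVec T 3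
      × (∀ σ → IsOmegaOrdering T σ → Backward σ u v ⊎ Backward σ w x ⊎ Backward σ y z)
      × (Σ (Order n) λ σ → IsOmegaOrdering T σ × Forward σ u v × Forward σ w x)
      × (Σ (Order n) λ σ → IsOmegaOrdering T σ × Forward σ u v × Forward σ y z)
      × (Σ (Order n) λ σ → IsOmegaOrdering T σ × Forward σ w x × Forward σ y z)
lemma3p8 =
  20 , T-clause , u , v , w , x , y , z , refl , refl , refl ,
  ((λ ()) , (λ ()) , (λ ()) , (λ ())) ,
  ((λ ()) , (λ ()) , (λ ()) , (λ ())) ,
  ((λ ()) , (λ ()) , (λ ()) , (λ ())) ,
  ω⃗-T-clause , omegaOrdering-clause ,
  (σ-uv-wx , K4Free⇒omegaOrdering σ-uv-wx σ-uv-wx-K4Free ,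
   from-yes (forward? σ-uv-wx u v) , from-yes (forward? σ-uv-wx w x)) ,
  (σ-uv-yz , K4Free⇒omegaOrdering σ-uv-yz σ-uv-yz-K4Free ,
   from-yes (forward? σ-uv-yz u v) , from-yes (forward? σ-uv-yz y z)) ,
  (σ-wx-yz , K4Free⇒omegaOrdering σ-wx-yz σ-wx-yz-K4Free ,
   from-yes (forward? σ-wx-yz w x) , from-yes (forward? σ-wx-yz y z))
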